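{- The strong $4$-colour graph $S_4(P_5)$ of the path $P_5$ on $5$ vertices is connected.
   Context: A proper $k$-colouring of a graph $G$ is a map $V(G)\to\{1,\dots,k\}$ giving adjacent vertices different colours; it is strong if all $k$ colours appear. The strong $k$-colour graph $S_k(G)$ has the strong $k$-colourings of $G$ as vertices, two being adjacent iff they differ in colour on exactly one vertex of $G$. -}

module Defs where

open import Data.Nat using (ℕ; suc)
open import Data.Fin using (Fin; toℕ)
open import Data.Product using (Σ; ∃; _×_; _,_)
open import Relation.Binary.PropositionalEquality using (_≡_; _≢_)
open import Relation.Binary.Construct.Closure.ReflexiveTransitive using (Star)
open import Function.Definitions using (Surjective)

record Graph (n : ℕ) : Set₁ where
  field
    Adj : Fin n → Fin n → Set

open Graph public

Path : (n : ℕ) → Graph n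
Path n = record { Adj = λ i j → (suc (toℕ i) ≡ toℕ j) Data.Sum.⊎ (suc (toℕ j) ≡ toℕ i) }
  where import Data.Sum

Colouring : (n k : ℕ) → Set
Colouring n k = Fin n → Fin k

Proper : ∀ {n} (G : Graph n) (k : ℕ) → Colouring n k → Set
Proper G k c = ∀ u v → Adj G u v → c u ≢ c v

Strong : ∀ {n} (G : Graph n) (k : ℕ) → Colouring n k → Set
Strong G k c = Proper G k c × Surjective _≡_ _≡_ c

StrongColouring : ∀ {n} (G : Graph n) (k : ℕ) → Set
StrongColouring G k = Σ (Colouring _ k) (Strong G k)

DifferOnExactlyOne : ∀ {n k} → Colouring n k → Colouring n k → Set
DifferOnExactlyOne {n} c d = ∃ λ (v : Fin n) → (c v ≢ d v) × (∀ w → w ≢ v → c w ≡ d w)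

SAdj : ∀ {n} (G : Graph n) (k : ℕ) → StrongColouring G k → StrongColouring G k → Set
SAdj G k (c , _) (d , _) = DifferOnExactlyOne c d

SConnected : ∀ {n} (G : Graph n) (k : ℕ) → Set
SConnected G k = ∀ (α β : StrongColouring G k) → Star (SAdj G k) α β

-- A strong 4-colouring of P₅ repeats exactly one colour, on one of the six non-adjacent
-- pairs of vertices, so S₄(P₅) has 6 · 4! = 144 vertices, and a colouring can only move by
-- recolouring a vertex of its repeated pair.  A breadth-first spanning tree of S₄(P₅)
-- rooted at the colouring 0 1 0 2 3 is recorded as a table telling each other vertex which
-- recolouring brings it one step closer to the root; a computation checks that following
-- the table from any strong colouring stays strong and reaches the root within 18 steps.
module Submission where

open import Defs
open import Data.Bool.Properties using (T?)
open import Data.Empty using (⊥-elim)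
open import Data.Fin using (Fin; suc; toℕ; inject₁; _≟_)
open import Data.Fin.Patterns using (0F; 1F; 2F; 3F; 4F)
open import Data.Fin.Properties using (all?; any?; toℕ-inject₁; toℕ-injective)
open import Data.Maybe using (Maybe; just; nothing; zipWith; is-just; to-witness-T; from-just)
import Data.Maybe as Maybe
open import Data.Nat using (ℕ; zero; suc)
open import Data.Nat.Properties using (suc-injective)
open import Data.Product using (∃; _×_; _,_; proj₁; proj₂)
open import Data.Sum using (inj₁; [_,_])
open import Data.Unit using (tt)
open import Data.Vec using (Vec; []; _∷_; lookup; tabulate; _[_]≔_)
open import Data.Vec.Properties using (≡-dec; lookup∘update; lookup∘update′; lookup∘tabulate)
open import Function using (_∘_; const)
open import Function.Bundles using (_⇔_; mk⇔)
import Function.Properties.Equivalence as ⇔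
open import Function.Definitions using (Surjective)
open import Level using (0ℓ)
open import Relation.Binary using (Rel; Symmetric; DecidableEquality)
open import Relation.Binary.Construct.Closure.ReflexiveTransitive using (Star; ε; _◅_; _◅◅_; reverse)
open import Relation.Binary.PropositionalEquality using (_≡_; _≢_; _≗_; refl; sym; trans; cong; subst)
open import Relation.Nullary using (Dec; yes; no; ¬?)
open import Relation.Nullary.Decidable using (map; map′; _×-dec_; toWitness)
open import Relation.Unary using (Pred; Decidable)

private
  variable
    n k : ℕ
    c d e : Colouring n k

DifferOnExactlyOne-sym : DifferOnExactlyOne c d → DifferOnExactlyOne d c
DifferOnExactlyOne-sym (v , c≢d , same) = v , c≢d ∘ sym , λ w w≢v → sym (same w w≢v)

DifferOnExactlyOne-respˡ : c ≗ d → DifferOnExactlyOne d e → DifferOnExactlyOne c e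
DifferOnExactlyOne-respˡ c≗d (v , d≢e , same) =
  v , d≢e ∘ trans (sym (c≗d v)) , λ w w≢v → trans (c≗d w) (same w w≢v)

Star-SAdj-sym : (G : Graph n) → Symmetric (Star (SAdj G k))
Star-SAdj-sym G = reverse (λ {α} {β} → DifferOnExactlyOne-sym)

Strong-resp-≗ : (G : Graph n) → c ≗ d → Strong G k c → Strong G k d
Strong-resp-≗ G c≗d (proper , onto) =
  (λ u v uv du≡dv → proper u v uv (trans (c≗d u) (trans du≡dv (sym (c≗d v))))) ,
  (λ a → proj₁ (onto a) , λ { refl → trans (sym (c≗d _)) (proj₂ (onto a) refl) })

-- The walk is needed because the two vertices may carry different proofs of strongness.
≗⇒Star : (G : Graph n) → c ≗ d → Strong G k e → DifferOnExactlyOne d e →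
         ∀ {p q} → Star (SAdj G k) (c , p) (d , q)
≗⇒Star G c≗d e-strong d~e =
  _◅_ {j = _ , e-strong} (DifferOnExactlyOne-respˡ c≗d d~e) (DifferOnExactlyOne-sym d~e ◅ ε)

Proper-Path⇔ : {c : Colouring (suc n) k} →
               Proper (Path (suc n)) k c ⇔ (∀ (i : Fin n) → c (inject₁ i) ≢ c (suc i))
Proper-Path⇔ {c = c} = mk⇔
  (λ proper i → proper (inject₁ i) (suc i) (inj₁ (cong suc (toℕ-inject₁ i))))
  (λ consecutive u v → [ successor consecutive u v , (λ vu → successor consecutive v u vu ∘ sym) ])
  where
  successor : (∀ i → c (inject₁ i) ≢ c (suc i)) → ∀ u v → suc (toℕ u) ≡ toℕ v → c u ≢ c v
  successor consecutive u (suc v) uv =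
    subst (λ w → c w ≢ c (suc v))
          (sym (toℕ-injective (trans (suc-injective uv) (sym (toℕ-inject₁ v)))))
          (consecutive v)

surjective? : (c : Colouring n k) → Dec (Surjective _≡_ _≡_ c)
surjective? c = map′ (λ onto a → proj₁ (onto a) , λ { refl → proj₂ (onto a) })
                     (λ onto a → proj₁ (onto a) , proj₂ (onto a) refl)
                     (all? λ a → any? λ v → c v ≟ a)

Strong-Path? : (c : Colouring (suc n) k) → Dec (Strong (Path (suc n)) k c)
Strong-Path? c = map (⇔.sym Proper-Path⇔) (all? λ i → ¬? (c (inject₁ i) ≟ c (suc i))) ×-dec surjective? c

allVectors? : ∀ {p} {P : Pred (Vec (Fin k) n) p} → Decidable P → Dec (∀ xs → P xs)
allVectors? {n = zero}  P? = map′ (λ { p [] → p }) (λ ∀p → ∀p []) (P? [])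
allVectors? {n = suc n} P? = map′ (λ { ∀p (x ∷ xs) → ∀p x xs }) (λ ∀p x xs → ∀p (x ∷ xs))
                                  (all? λ x → allVectors? λ xs → P? (x ∷ xs))

recolour-differs : (xs : Vec (Fin k) n) (i : Fin n) {a : Fin k} → lookup xs i ≢ a →
                   DifferOnExactlyOne (lookup xs) (lookup (xs [ i ]≔ a))
recolour-differs xs i {a} xsᵢ≢a =
  i , (λ eq → xsᵢ≢a (trans eq (lookup∘update i xs a))) , λ w w≢i → sym (lookup∘update′ w≢i xs a)

module _ {a r} {A : Set a} {R : Rel A r} (_≟ᴬ_ : DecidableEquality A) (t : A)
         (next : A → A) (step : ∀ x → Maybe (R x (next x))) where

  follow : ℕ → ∀ x → Maybe (Star R x t)
  follow zero    x = nothing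
  follow (suc fuel) x with x ≟ᴬ t
  ... | yes refl = just ε
  ... | no _     = zipWith _◅_ (step x) (follow fuel (next x))

-- Vertices of S_k(G) encoded as vectors, so that they can be compared and enumerated.
module Codes (G : Graph n) (k : ℕ) (strong? : (c : Colouring n k) → Dec (Strong G k c)) where

  Move : Rel (Vec (Fin k) n) 0ℓ
  Move xs ys = Strong G k (lookup ys) × DifferOnExactlyOne (lookup xs) (lookup ys)

  recolour : Vec (Fin k) n → Fin n × Fin k → Vec (Fin k) n
  recolour xs (i , a) = xs [ i ]≔ a

  move? : ∀ xs m → Maybe (Move xs (recolour xs m))
  move? xs (i , a) with lookup xs i ≟ a | strong? (lookup (xs [ i ]≔ a))
  ... | no xsᵢ≢a | yes strong = just (strong , recolour-differs xs i xsᵢ≢a)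
  ... | _        | _          = nothing

  Star-Move⇒Star-SAdj : ∀ {xs ys} {c : Colouring n k} → ∃ (Move ys) → c ≗ lookup xs →
                        Star Move xs ys → ∀ {p q} → Star (SAdj G k) (c , p) (lookup ys , q)
  Star-Move⇒Star-SAdj (_ , strong , ys~zs) c≗xs ε = ≗⇒Star G c≗xs strong ys~zs
  Star-Move⇒Star-SAdj ys→zs c≗xs ((strong , xs~ws) ◅ ws→ys) =
    DifferOnExactlyOne-respˡ c≗xs xs~ws ◅ Star-Move⇒Star-SAdj ys→zs (λ _ → refl) ws→ys {p = strong}

Code : Set
Code = Vec (Fin 4) 5

open Codes (Path 5) 4 Strong-Path?

root : Code
root = 0F ∷ 1F ∷ 0F ∷ 2F ∷ 3F ∷ []

-- Generated by a breadth-first search from root.  The last clause is a junk value: it is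
-- never consulted, since following the table stops at root and starts only at strong codes.
towardsRoot : Code → Fin 5 × Fin 4
towardsRoot (0F ∷ 1F ∷ 0F ∷ 3F ∷ 2F ∷ []) = 2F , 2F
towardsRoot (0F ∷ 1F ∷ 2F ∷ 0F ∷ 3F ∷ []) = 3F , 1F
towardsRoot (0F ∷ 1F ∷ 2F ∷ 1F ∷ 3F ∷ []) = 1F , 3F
towardsRoot (0F ∷ 1F ∷ 2F ∷ 3F ∷ 0F ∷ []) = 0F , 3F
towardsRoot (0F ∷ 1F ∷ 2F ∷ 3F ∷ 1F ∷ []) = 4F , 0F
towardsRoot (0F ∷ 1F ∷ 2F ∷ 3F ∷ 2F ∷ []) = 4F , 0F
towardsRoot (0F ∷ 1F ∷ 3F ∷ 0F ∷ 2F ∷ []) = 0F , 2F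
towardsRoot (0F ∷ 1F ∷ 3F ∷ 1F ∷ 2F ∷ []) = 3F , 0F
towardsRoot (0F ∷ 1F ∷ 3F ∷ 2F ∷ 0F ∷ []) = 4F , 3F
towardsRoot (0F ∷ 1F ∷ 3F ∷ 2F ∷ 1F ∷ []) = 4F , 3F
towardsRoot (0F ∷ 1F ∷ 3F ∷ 2F ∷ 3F ∷ []) = 2F , 0F
towardsRoot (0F ∷ 2F ∷ 0F ∷ 1F ∷ 3F ∷ []) = 0F , 1F
towardsRoot (0F ∷ 2F ∷ 0F ∷ 3F ∷ 1F ∷ []) = 0F , 3F
towardsRoot (0F ∷ 2F ∷ 1F ∷ 0F ∷ 3F ∷ []) = 0F , 1F
towardsRoot (0F ∷ 2F ∷ 1F ∷ 2F ∷ 3F ∷ []) = 3F , 0F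
towardsRoot (0F ∷ 2F ∷ 1F ∷ 3F ∷ 0F ∷ []) = 4F , 1F
towardsRoot (0F ∷ 2F ∷ 1F ∷ 3F ∷ 1F ∷ []) = 2F , 0F
towardsRoot (0F ∷ 2F ∷ 1F ∷ 3F ∷ 2F ∷ []) = 4F , 1F
towardsRoot (0F ∷ 2F ∷ 3F ∷ 0F ∷ 1F ∷ []) = 3F , 2F
towardsRoot (0F ∷ 2F ∷ 3F ∷ 1F ∷ 0F ∷ []) = 4F , 2F
towardsRoot (0F ∷ 2F ∷ 3F ∷ 1F ∷ 2F ∷ []) = 1F , 1F
towardsRoot (0F ∷ 2F ∷ 3F ∷ 1F ∷ 3F ∷ []) = 4F , 2F
towardsRoot (0F ∷ 2F ∷ 3F ∷ 2F ∷ 1F ∷ []) = 1F , 1F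
towardsRoot (0F ∷ 3F ∷ 0F ∷ 1F ∷ 2F ∷ []) = 0F , 2F
towardsRoot (0F ∷ 3F ∷ 0F ∷ 2F ∷ 1F ∷ []) = 2F , 1F
towardsRoot (0F ∷ 3F ∷ 1F ∷ 0F ∷ 2F ∷ []) = 3F , 3F
towardsRoot (0F ∷ 3F ∷ 1F ∷ 2F ∷ 0F ∷ []) = 4F , 3F
towardsRoot (0F ∷ 3F ∷ 1F ∷ 2F ∷ 1F ∷ []) = 4F , 3F
towardsRoot (0F ∷ 3F ∷ 1F ∷ 2F ∷ 3F ∷ []) = 1F , 2F
towardsRoot (0F ∷ 3F ∷ 1F ∷ 3F ∷ 2F ∷ []) = 1F , 2F
towardsRoot (0F ∷ 3F ∷ 2F ∷ 0F ∷ 1F ∷ []) = 0F , 1F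
towardsRoot (0F ∷ 3F ∷ 2F ∷ 1F ∷ 0F ∷ []) = 0F , 2F
towardsRoot (0F ∷ 3F ∷ 2F ∷ 1F ∷ 2F ∷ []) = 2F , 0F
towardsRoot (0F ∷ 3F ∷ 2F ∷ 1F ∷ 3F ∷ []) = 4F , 0F
towardsRoot (0F ∷ 3F ∷ 2F ∷ 3F ∷ 1F ∷ []) = 3F , 0F
towardsRoot (1F ∷ 0F ∷ 1F ∷ 2F ∷ 3F ∷ []) = 0F , 3F
towardsRoot (1F ∷ 0F ∷ 1F ∷ 3F ∷ 2F ∷ []) = 0F , 3F
towardsRoot (1F ∷ 0F ∷ 2F ∷ 0F ∷ 3F ∷ []) = 3F , 1F
towardsRoot (1F ∷ 0F ∷ 2F ∷ 1F ∷ 3F ∷ []) = 0F , 2F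
towardsRoot (1F ∷ 0F ∷ 2F ∷ 3F ∷ 0F ∷ []) = 1F , 3F
towardsRoot (1F ∷ 0F ∷ 2F ∷ 3F ∷ 1F ∷ []) = 4F , 0F
towardsRoot (1F ∷ 0F ∷ 2F ∷ 3F ∷ 2F ∷ []) = 4F , 0F
towardsRoot (1F ∷ 0F ∷ 3F ∷ 0F ∷ 2F ∷ []) = 1F , 2F
towardsRoot (1F ∷ 0F ∷ 3F ∷ 1F ∷ 2F ∷ []) = 0F , 2F
towardsRoot (1F ∷ 0F ∷ 3F ∷ 2F ∷ 0F ∷ []) = 4F , 1F
towardsRoot (1F ∷ 0F ∷ 3F ∷ 2F ∷ 1F ∷ []) = 0F , 3F
towardsRoot (1F ∷ 0F ∷ 3F ∷ 2F ∷ 3F ∷ []) = 2F , 1F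
towardsRoot (1F ∷ 2F ∷ 0F ∷ 1F ∷ 3F ∷ []) = 3F , 2F
towardsRoot (1F ∷ 2F ∷ 0F ∷ 2F ∷ 3F ∷ []) = 1F , 3F
towardsRoot (1F ∷ 2F ∷ 0F ∷ 3F ∷ 0F ∷ []) = 4F , 1F
towardsRoot (1F ∷ 2F ∷ 0F ∷ 3F ∷ 1F ∷ []) = 0F , 3F
towardsRoot (1F ∷ 2F ∷ 0F ∷ 3F ∷ 2F ∷ []) = 4F , 1F
towardsRoot (1F ∷ 2F ∷ 1F ∷ 0F ∷ 3F ∷ []) = 2F , 3F
towardsRoot (1F ∷ 2F ∷ 1F ∷ 3F ∷ 0F ∷ []) = 2F , 0F
towardsRoot (1F ∷ 2F ∷ 3F ∷ 0F ∷ 1F ∷ []) = 0F , 0F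
towardsRoot (1F ∷ 2F ∷ 3F ∷ 0F ∷ 2F ∷ []) = 4F , 1F
towardsRoot (1F ∷ 2F ∷ 3F ∷ 0F ∷ 3F ∷ []) = 4F , 1F
towardsRoot (1F ∷ 2F ∷ 3F ∷ 1F ∷ 0F ∷ []) = 3F , 2F
towardsRoot (1F ∷ 2F ∷ 3F ∷ 2F ∷ 0F ∷ []) = 1F , 0F
towardsRoot (1F ∷ 3F ∷ 0F ∷ 1F ∷ 2F ∷ []) = 0F , 2F
towardsRoot (1F ∷ 3F ∷ 0F ∷ 2F ∷ 0F ∷ []) = 2F , 1F
towardsRoot (1F ∷ 3F ∷ 0F ∷ 2F ∷ 1F ∷ []) = 0F , 0F
towardsRoot (1F ∷ 3F ∷ 0F ∷ 2F ∷ 3F ∷ []) = 4F , 0F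
towardsRoot (1F ∷ 3F ∷ 0F ∷ 3F ∷ 2F ∷ []) = 3F , 1F
towardsRoot (1F ∷ 3F ∷ 1F ∷ 0F ∷ 2F ∷ []) = 0F , 0F
towardsRoot (1F ∷ 3F ∷ 1F ∷ 2F ∷ 0F ∷ []) = 0F , 0F
towardsRoot (1F ∷ 3F ∷ 2F ∷ 0F ∷ 1F ∷ []) = 4F , 3F
towardsRoot (1F ∷ 3F ∷ 2F ∷ 0F ∷ 2F ∷ []) = 2F , 1F
towardsRoot (1F ∷ 3F ∷ 2F ∷ 0F ∷ 3F ∷ []) = 1F , 0F
towardsRoot (1F ∷ 3F ∷ 2F ∷ 1F ∷ 0F ∷ []) = 0F , 2F
towardsRoot (1F ∷ 3F ∷ 2F ∷ 3F ∷ 0F ∷ []) = 3F , 1F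
towardsRoot (2F ∷ 0F ∷ 1F ∷ 0F ∷ 3F ∷ []) = 1F , 3F
towardsRoot (2F ∷ 0F ∷ 1F ∷ 2F ∷ 3F ∷ []) = 0F , 3F
towardsRoot (2F ∷ 0F ∷ 1F ∷ 3F ∷ 0F ∷ []) = 4F , 2F
towardsRoot (2F ∷ 0F ∷ 1F ∷ 3F ∷ 1F ∷ []) = 2F , 2F
towardsRoot (2F ∷ 0F ∷ 1F ∷ 3F ∷ 2F ∷ []) = 0F , 3F
towardsRoot (2F ∷ 0F ∷ 2F ∷ 1F ∷ 3F ∷ []) = 2F , 3F
towardsRoot (2F ∷ 0F ∷ 2F ∷ 3F ∷ 1F ∷ []) = 0F , 1F
towardsRoot (2F ∷ 0F ∷ 3F ∷ 0F ∷ 1F ∷ []) = 1F , 1F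
towardsRoot (2F ∷ 0F ∷ 3F ∷ 1F ∷ 0F ∷ []) = 1F , 1F
towardsRoot (2F ∷ 0F ∷ 3F ∷ 1F ∷ 2F ∷ []) = 4F , 0F
towardsRoot (2F ∷ 0F ∷ 3F ∷ 1F ∷ 3F ∷ []) = 4F , 0F
towardsRoot (2F ∷ 0F ∷ 3F ∷ 2F ∷ 1F ∷ []) = 0F , 3F
towardsRoot (2F ∷ 1F ∷ 0F ∷ 1F ∷ 3F ∷ []) = 3F , 2F
towardsRoot (2F ∷ 1F ∷ 0F ∷ 2F ∷ 3F ∷ []) = 0F , 0F
towardsRoot (2F ∷ 1F ∷ 0F ∷ 3F ∷ 0F ∷ []) = 2F , 2F
towardsRoot (2F ∷ 1F ∷ 0F ∷ 3F ∷ 1F ∷ []) = 4F , 0F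
towardsRoot (2F ∷ 1F ∷ 0F ∷ 3F ∷ 2F ∷ []) = 4F , 0F
towardsRoot (2F ∷ 1F ∷ 2F ∷ 0F ∷ 3F ∷ []) = 0F , 0F
towardsRoot (2F ∷ 1F ∷ 2F ∷ 3F ∷ 0F ∷ []) = 0F , 3F
towardsRoot (2F ∷ 1F ∷ 3F ∷ 0F ∷ 1F ∷ []) = 4F , 3F
towardsRoot (2F ∷ 1F ∷ 3F ∷ 0F ∷ 2F ∷ []) = 4F , 3F
towardsRoot (2F ∷ 1F ∷ 3F ∷ 0F ∷ 3F ∷ []) = 2F , 2F
towardsRoot (2F ∷ 1F ∷ 3F ∷ 1F ∷ 0F ∷ []) = 3F , 2F
towardsRoot (2F ∷ 1F ∷ 3F ∷ 2F ∷ 0F ∷ []) = 0F , 0F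
towardsRoot (2F ∷ 3F ∷ 0F ∷ 1F ∷ 0F ∷ []) = 4F , 3F
towardsRoot (2F ∷ 3F ∷ 0F ∷ 1F ∷ 2F ∷ []) = 4F , 3F
towardsRoot (2F ∷ 3F ∷ 0F ∷ 1F ∷ 3F ∷ []) = 1F , 1F
towardsRoot (2F ∷ 3F ∷ 0F ∷ 2F ∷ 1F ∷ []) = 0F , 0F
towardsRoot (2F ∷ 3F ∷ 0F ∷ 3F ∷ 1F ∷ []) = 3F , 2F
towardsRoot (2F ∷ 3F ∷ 1F ∷ 0F ∷ 1F ∷ []) = 4F , 2F
towardsRoot (2F ∷ 3F ∷ 1F ∷ 0F ∷ 2F ∷ []) = 0F , 0F
towardsRoot (2F ∷ 3F ∷ 1F ∷ 0F ∷ 3F ∷ []) = 4F , 2F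
towardsRoot (2F ∷ 3F ∷ 1F ∷ 2F ∷ 0F ∷ []) = 0F , 0F
towardsRoot (2F ∷ 3F ∷ 1F ∷ 3F ∷ 0F ∷ []) = 1F , 0F
towardsRoot (2F ∷ 3F ∷ 2F ∷ 0F ∷ 1F ∷ []) = 0F , 1F
towardsRoot (2F ∷ 3F ∷ 2F ∷ 1F ∷ 0F ∷ []) = 2F , 0F
towardsRoot (3F ∷ 0F ∷ 1F ∷ 0F ∷ 2F ∷ []) = 1F , 2F
towardsRoot (3F ∷ 0F ∷ 1F ∷ 2F ∷ 0F ∷ []) = 1F , 2F
towardsRoot (3F ∷ 0F ∷ 1F ∷ 2F ∷ 1F ∷ []) = 4F , 0F
towardsRoot (3F ∷ 0F ∷ 1F ∷ 2F ∷ 3F ∷ []) = 4F , 0F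
towardsRoot (3F ∷ 0F ∷ 1F ∷ 3F ∷ 2F ∷ []) = 3F , 0F
towardsRoot (3F ∷ 0F ∷ 2F ∷ 0F ∷ 1F ∷ []) = 3F , 3F
towardsRoot (3F ∷ 0F ∷ 2F ∷ 1F ∷ 0F ∷ []) = 4F , 2F
towardsRoot (3F ∷ 0F ∷ 2F ∷ 1F ∷ 2F ∷ []) = 2F , 3F
towardsRoot (3F ∷ 0F ∷ 2F ∷ 1F ∷ 3F ∷ []) = 0F , 2F
towardsRoot (3F ∷ 0F ∷ 2F ∷ 3F ∷ 1F ∷ []) = 0F , 1F
towardsRoot (3F ∷ 0F ∷ 3F ∷ 1F ∷ 2F ∷ []) = 0F , 2F
towardsRoot (3F ∷ 0F ∷ 3F ∷ 2F ∷ 1F ∷ []) = 2F , 1F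
towardsRoot (3F ∷ 1F ∷ 0F ∷ 1F ∷ 2F ∷ []) = 3F , 3F
towardsRoot (3F ∷ 1F ∷ 0F ∷ 2F ∷ 0F ∷ []) = 4F , 3F
towardsRoot (3F ∷ 1F ∷ 0F ∷ 2F ∷ 1F ∷ []) = 4F , 3F
towardsRoot (3F ∷ 1F ∷ 0F ∷ 2F ∷ 3F ∷ []) = 0F , 0F
towardsRoot (3F ∷ 1F ∷ 0F ∷ 3F ∷ 2F ∷ []) = 0F , 0F
towardsRoot (3F ∷ 1F ∷ 2F ∷ 0F ∷ 1F ∷ []) = 4F , 3F
towardsRoot (3F ∷ 1F ∷ 2F ∷ 0F ∷ 2F ∷ []) = 4F , 3F
towardsRoot (3F ∷ 1F ∷ 2F ∷ 0F ∷ 3F ∷ []) = 0F , 0F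
towardsRoot (3F ∷ 1F ∷ 2F ∷ 1F ∷ 0F ∷ []) = 1F , 0F
towardsRoot (3F ∷ 1F ∷ 2F ∷ 3F ∷ 0F ∷ []) = 3F , 1F
towardsRoot (3F ∷ 1F ∷ 3F ∷ 0F ∷ 2F ∷ []) = 2F , 2F
towardsRoot (3F ∷ 1F ∷ 3F ∷ 2F ∷ 0F ∷ []) = 0F , 0F
towardsRoot (3F ∷ 2F ∷ 0F ∷ 1F ∷ 0F ∷ []) = 2F , 3F
towardsRoot (3F ∷ 2F ∷ 0F ∷ 1F ∷ 2F ∷ []) = 1F , 1F
towardsRoot (3F ∷ 2F ∷ 0F ∷ 1F ∷ 3F ∷ []) = 0F , 1F
towardsRoot (3F ∷ 2F ∷ 0F ∷ 2F ∷ 1F ∷ []) = 1F , 1F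
towardsRoot (3F ∷ 2F ∷ 0F ∷ 3F ∷ 1F ∷ []) = 3F , 2F
towardsRoot (3F ∷ 2F ∷ 1F ∷ 0F ∷ 1F ∷ []) = 2F , 3F
towardsRoot (3F ∷ 2F ∷ 1F ∷ 0F ∷ 2F ∷ []) = 4F , 1F
towardsRoot (3F ∷ 2F ∷ 1F ∷ 0F ∷ 3F ∷ []) = 4F , 1F
towardsRoot (3F ∷ 2F ∷ 1F ∷ 2F ∷ 0F ∷ []) = 3F , 3F
towardsRoot (3F ∷ 2F ∷ 1F ∷ 3F ∷ 0F ∷ []) = 0F , 0F
towardsRoot (3F ∷ 2F ∷ 3F ∷ 0F ∷ 1F ∷ []) = 0F , 0F
towardsRoot (3F ∷ 2F ∷ 3F ∷ 1F ∷ 0F ∷ []) = 0F , 0F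
towardsRoot _ = 0F , 0F

-- Fuel 19 = 18 steps (the eccentricity of root) plus the final call that recognises root.
toRoot? : (xs : Code) → Maybe (Strong (Path 5) 4 (lookup xs) → Star Move xs root)
toRoot? xs with Strong-Path? (lookup xs)
... | yes _      = Maybe.map const (follow (≡-dec _≟_) root (λ ys → recolour ys (towardsRoot ys))
                                           (λ ys → move? ys (towardsRoot ys)) 19 xs)
... | no ¬strong = just (⊥-elim ∘ ¬strong)

spanningTree : (xs : Code) → Strong (Path 5) 4 (lookup xs) → Star Move xs root
spanningTree xs = to-witness-T (toRoot? xs)
  (toWitness {a? = allVectors? λ ys → T? (is-just (toRoot? ys))} tt xs)

rootMove : ∃ (Move root)
rootMove = recolour root (0F , 2F) , from-just (move? root (0F , 2F))

rootStrong : Strong (Path 5) 4 (lookup root)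
rootStrong = toWitness {a? = Strong-Path? (lookup root)} tt

walkToRoot : (α : StrongColouring (Path 5) 4) → Star (SAdj (Path 5) 4) α (lookup root , rootStrong)
walkToRoot (c , strong) =
  Star-Move⇒Star-SAdj rootMove c≗xs (spanningTree xs (Strong-resp-≗ (Path 5) c≗xs strong))
  where
  xs : Code
  xs = tabulate c
  c≗xs : c ≗ lookup xs
  c≗xs i = sym (lookup∘tabulate c i)

proposition3p1 : SConnected (Path 5) 4
proposition3p1 α β = walkToRoot α ◅◅ Star-SAdj-sym (Path 5) (walkToRoot β)
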